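{- For every derivation of the shape $T\xrightarrow{\{\mathsf{e}\downarrow\}}W_1\xrightarrow{\{\mathsf{g}\uparrow\}}W_2\xrightarrow{\{\mathsf{b}\uparrow\}}W_3\xrightarrow{\{\mathsf{w}\uparrow\}}W_4\xrightarrow{\{\mathsf{ai}\downarrow\}}W_5\xrightarrow{\mathsf{SNELh}}Z_5\xrightarrow{\{\mathsf{ai}\uparrow\}}Z_4\xrightarrow{\{\mathsf{w}\downarrow\}}Z_3\xrightarrow{\{\mathsf{b}\downarrow\}}Z_2\xrightarrow{\{\mathsf{g}\downarrow\}}Z_1\xrightarrow{\{\mathsf{e}\uparrow\}}R$ there is a derivation of the shape $T\xrightarrow{\{\mathsf{g}\uparrow\}}T_1\xrightarrow{\{\mathsf{b}\uparrow\}}T_2\xrightarrow{\{\mathsf{w}\uparrow\}}T_3\xrightarrow{\{\mathsf{e}\downarrow\}}T_4\xrightarrow{\{\mathsf{ai}\downarrow\}}T_5\xrightarrow{\mathsf{SNELh}}R_5\xrightarrow{\{\mathsf{ai}\uparrow\}}R_4\xrightarrow{\{\mathsf{e}\uparrow\}}R_3\xrightarrow{\{\mathsf{w}\downarrow\}}R_2\xrightarrow{\{\mathsf{b}\downarrow\}}R_1\xrightarrow{\{\mathsf{g}\downarrow\}}R$ for some intermediate structures.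
   Context: Atoms: countably many atoms $a,b,\dots$, each atom $a$ having a dual atom $\bar a$ with $\bar{\bar a}=a$. Structures are generated by $S::= a\mid \circ \mid [S,\dots,S]\mid (S,\dots,S)\mid \langle S;\dots;S\rangle \mid ?S\mid !S\mid \bar S$ (par, tensor, seq with at least one argument; unit $\circ$ not an atom), identified modulo the least congruence $=$ making par, tensor, seq associative, par and tensor commutative, $\circ$ a unit for all three, $[R]=(R)=\langle R\rangle=R$, with $\bar\circ=\circ$, $\overline{[R_1,\dots,R_h]}=(\bar R_1,\dots,\bar R_h)$, $\overline{(R_1,\dots,R_h)}=[\bar R_1,\dots,\bar R_h]$, $\overline{\langle R_1;\dots;R_h\rangle}=\langle\bar R_1;\dots;\bar R_h\rangle$, $\overline{?R}=!\bar R$, $\overline{!R}=?\bar R$, $\bar{\bar R}=R$. A context $S\{\;\}$ is a structure with one hole not under negation; $S[R,T]$ abbreviates $S\{[R,T]\}$ etc. A derivation in a rule set is a finite vertical chain of rule instances (each conclusion equal modulo $=$ to the next premise), possibly a single structure; top = premise, bottom = conclusion. Rules (premise $\Rightarrow$ conclusion): $\mathsf{ai}\downarrow$: $S\{\circ\}\Rightarrow S[a,\bar a]$; $\mathsf{ai}\uparrow$: $S(a,\bar a)\Rightarrow S\{\circ\}$; $\mathsf{s}$: $S([R,U],T)\Rightarrow S[(R,T),U]$; $\mathsf{q}\downarrow$: $S\langle[R,U];[T,V]\rangle\Rightarrow S[\langle R;T\rangle,\langle U;V\rangle]$; $\mathsf{q}\uparrow$: $S(\langle R;U\rangle,\langle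 T;V\rangle)\Rightarrow S\langle(R,T);(U,V)\rangle$; $\mathsf{p}\downarrow$: $S\{![R,T]\}\Rightarrow S[!R,?T]$; $\mathsf{p}\uparrow$: $S(?R,!T)\Rightarrow S\{?(R,T)\}$; $\mathsf{e}\downarrow$: $S\{\circ\}\Rightarrow S\{!\circ\}$; $\mathsf{e}\uparrow$: $S\{?\circ\}\Rightarrow S\{\circ\}$; $\mathsf{w}\downarrow$: $S\{\circ\}\Rightarrow S\{?R\}$; $\mathsf{w}\uparrow$: $S\{!R\}\Rightarrow S\{\circ\}$; $\mathsf{b}\downarrow$: $S[?R,R]\Rightarrow S\{?R\}$; $\mathsf{b}\uparrow$: $S\{!R\}\Rightarrow S(!R,R)$; $\mathsf{g}\downarrow$: $S\{??R\}\Rightarrow S\{?R\}$; $\mathsf{g}\uparrow$: $S\{!R\}\Rightarrow S\{!!R\}$. $\mathsf{SNELh}=\{\mathsf{s},\mathsf{q}\downarrow,\mathsf{q}\uparrow,\mathsf{p}\downarrow,\mathsf{p}\uparrow\}$. Notation $X_0\xrightarrow{\mathcal X_1}X_1\xrightarrow{\mathcal X_2}\cdots\xrightarrow{\mathcal X_k}X_k$ denotes a derivation from $X_0$ to $X_k$ obtained by stacking, for each $i$, a derivation from $X_{i-1}$ to $X_i$ using only rules of $\mathcal X_i$ (possibly with no rule instance). -}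

module Defs where

open import Data.Nat using (ℕ)
open import Data.Bool using (Bool; not)
open import Data.Product using (_×_; _,_)
open import Relation.Binary.PropositionalEquality using (_≡_)

-- Atoms: countably many; an atom is a name together with a polarity.
-- The dual of (n , b) is (n , not b), so that dual (dual a) ≡ a.
Atom : Set
Atom = ℕ × Bool

dual : Atom → Atom
dual (n , b) = n , not b

-- Structures in negation normal form (negation is the defined operation neg).
-- n-ary par/tensor/seq are represented by binary ones (equal modulo
-- associativity and the unit laws); the unary case [R]=(R)=<R>=R is then trivial.
data Str : Set where
  atom : Atom → Str
  unit : Str                      -- ∘
  par  : Str → Str → Str          -- [R , T]
  tens : Str → Str → Str          -- (R , T)
  seq  : Str → Str → Str          -- < R ; T >
  why  : Str → Str
  bang : Str → Str

neg : Str → Str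
neg (atom a)   = atom (dual a)
neg unit       = unit
neg (par R T)  = tens (neg R) (neg T)
neg (tens R T) = par (neg R) (neg T)
neg (seq R T)  = seq (neg R) (neg T)
neg (why R)    = bang (neg R)
neg (bang R)   = why (neg R)

infix 4 _≃_
data _≃_ : Str → Str → Set where
  ≃-refl  : ∀ {R} → R ≃ R
  ≃-sym   : ∀ {R T} → R ≃ T → T ≃ R
  ≃-trans : ∀ {R T U} → R ≃ T → T ≃ U → R ≃ U
  par-cong  : ∀ {R R' T T'} → R ≃ R' → T ≃ T' → par R T ≃ par R' T'
  tens-cong : ∀ {R R' T T'} → R ≃ R' → T ≃ T' → tens R T ≃ tens R' T'
  seq-cong  : ∀ {R R' T T'} → R ≃ R' → T ≃ T' → seq R T ≃ seq R' T'
  why-cong  : ∀ {R R'} → R ≃ R' → why R ≃ why R'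
  bang-cong : ∀ {R R'} → R ≃ R' → bang R ≃ bang R'
  par-assoc  : ∀ R T U → par (par R T) U ≃ par R (par T U)
  tens-assoc : ∀ R T U → tens (tens R T) U ≃ tens R (tens T U)
  seq-assoc  : ∀ R T U → seq (seq R T) U ≃ seq R (seq T U)
  par-comm  : ∀ R T → par R T ≃ par T R
  tens-comm : ∀ R T → tens R T ≃ tens T R
  par-unitˡ  : ∀ R → par unit R ≃ R
  par-unitʳ  : ∀ R → par R unit ≃ R
  tens-unitˡ : ∀ R → tens unit R ≃ R
  tens-unitʳ : ∀ R → tens R unit ≃ R
  seq-unitˡ  : ∀ R → seq unit R ≃ R
  seq-unitʳ  : ∀ R → seq R unit ≃ R

data Ctx : Set where
  hole  : Ctx
  parL  : Ctx → Str → Ctx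
  parR  : Str → Ctx → Ctx
  tensL : Ctx → Str → Ctx
  tensR : Str → Ctx → Ctx
  seqL  : Ctx → Str → Ctx
  seqR  : Str → Ctx → Ctx
  whyC  : Ctx → Ctx
  bangC : Ctx → Ctx

_[_] : Ctx → Str → Str
hole      [ R ] = R
parL C S  [ R ] = par (C [ R ]) S
parR S C  [ R ] = par S (C [ R ])
tensL C S [ R ] = tens (C [ R ]) S
tensR S C [ R ] = tens S (C [ R ])
seqL C S  [ R ] = seq (C [ R ]) S
seqR S C  [ R ] = seq S (C [ R ])
whyC C    [ R ] = why (C [ R ])
bangC C   [ R ] = bang (C [ R ])

data Rule : Set where
  ai↓ ai↑ s q↓ q↑ p↓ p↑ e↓ e↑ w↓ w↑ b↓ b↑ g↓ g↑ : Rule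

-- Rule instances: P ⟶⟨ r ⟩ Q means P is the premise and Q the conclusion
-- of an instance of rule r.
data _⟶⟨_⟩_ : Str → Rule → Str → Set where
  ai↓-inst : ∀ C a → (C [ unit ]) ⟶⟨ ai↓ ⟩ (C [ par (atom a) (atom (dual a)) ])
  ai↑-inst : ∀ C a → (C [ tens (atom a) (atom (dual a)) ]) ⟶⟨ ai↑ ⟩ (C [ unit ])
  s-inst   : ∀ C R U T → (C [ tens (par R U) T ]) ⟶⟨ s ⟩ (C [ par (tens R T) U ])
  q↓-inst  : ∀ C R T U V → (C [ seq (par R U) (par T V) ]) ⟶⟨ q↓ ⟩ (C [ par (seq R T) (seq U V) ])
  q↑-inst  : ∀ C R T U V → (C [ tens (seq R U) (seq T V) ]) ⟶⟨ q↑ ⟩ (C [ seq (tens R T) (tens U V) ])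
  p↓-inst  : ∀ C R T → (C [ bang (par R T) ]) ⟶⟨ p↓ ⟩ (C [ par (bang R) (why T) ])
  p↑-inst  : ∀ C R T → (C [ tens (why R) (bang T) ]) ⟶⟨ p↑ ⟩ (C [ why (tens R T) ])
  e↓-inst  : ∀ C → (C [ unit ]) ⟶⟨ e↓ ⟩ (C [ bang unit ])
  e↑-inst  : ∀ C → (C [ why unit ]) ⟶⟨ e↑ ⟩ (C [ unit ])
  w↓-inst  : ∀ C R → (C [ unit ]) ⟶⟨ w↓ ⟩ (C [ why R ])
  w↑-inst  : ∀ C R → (C [ bang R ]) ⟶⟨ w↑ ⟩ (C [ unit ])
  b↓-inst  : ∀ C R → (C [ par (why R) R ]) ⟶⟨ b↓ ⟩ (C [ why R ])
  b↑-inst  : ∀ C R → (C [ bang R ]) ⟶⟨ b↑ ⟩ (C [ tens (bang R) R ])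
  g↓-inst  : ∀ C R → (C [ why (why R) ]) ⟶⟨ g↓ ⟩ (C [ why R ])
  g↑-inst  : ∀ C R → (C [ bang R ]) ⟶⟨ g↑ ⟩ (C [ bang (bang R) ])

RuleSet : Set₁
RuleSet = Rule → Set

only : Rule → RuleSet
only r r' = r' ≡ r

data SNELh : RuleSet where
  s∈   : SNELh s
  q↓∈  : SNELh q↓
  q↑∈  : SNELh q↑
  p↓∈  : SNELh p↓
  p↑∈  : SNELh p↑

-- Derivations (top = premise X, bottom = conclusion Y) using only rules of 𝓡;
-- consecutive structures are equal modulo ≃.  'done' is the derivation
-- consisting of a single structure (X and Y equal modulo ≃).
data Deriv (𝓡 : RuleSet) : Str → Str → Set where
  done : ∀ {X Y} → X ≃ Y → Deriv 𝓡 X Y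
  step : ∀ {X P Q Y} r → 𝓡 r → X ≃ P → P ⟶⟨ r ⟩ Q → Deriv 𝓡 Q Y → Deriv 𝓡 X Y

_─⟨_⟩→_ : Str → Rule → Str → Set
X ─⟨ r ⟩→ Y = Deriv (only r) X Y

_─SNELh→_ : Str → Str → Set
X ─SNELh→ Y = Deriv SNELh X Y

-- A derivation by e↓ alone only replaces occurrences of ∘ by "pure" structures,
-- built from ∘ by !, par, tensor and seq.  Instances of g↑, b↑ and w↑ applied to
-- such an expansion of T either act inside an inserted pure structure, whose result
-- is again pure, or on a ! already present in T; so they can be replayed on T
-- itself, and the remaining expansion is redone by e↓ afterwards.  Negation turns
-- the bottom half of the derivation into an instance of the top half.
module Submission where

open import Defs
open import Data.Empty using (⊥)
open import Data.Product using (Σ; _×_; _,_)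
open import Data.Bool.Properties using (not-involutive)
open import Relation.Binary.PropositionalEquality using (_≡_; refl; cong; cong₂; subst; subst₂)

private
  variable
    𝓡 𝓢 : RuleSet
    r : Rule
    A B P Q X X' X₁ X₂ Y Y' Y₁ Y₂ Z Z' : Str

none : RuleSet
none _ = ⊥

single : 𝓡 r → P ⟶⟨ r ⟩ Q → Deriv 𝓡 P Q
single r∈ i = step _ r∈ ≃-refl i (done ≃-refl)

Deriv-respˡ-≃ : X ≃ Y → Deriv 𝓡 Y Z → Deriv 𝓡 X Z
Deriv-respˡ-≃ e (done e')          = done (≃-trans e e')
Deriv-respˡ-≃ e (step r r∈ e' i d) = step r r∈ (≃-trans e e') i d

infixr 5 _◅◅_
_◅◅_ : Deriv 𝓡 X Y → Deriv 𝓡 Y Z → Deriv 𝓡 X Z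
done e          ◅◅ d' = Deriv-respˡ-≃ e d'
step r r∈ e i d ◅◅ d' = step r r∈ e i (d ◅◅ d')

Deriv-none⇒≃ : Deriv none X Y → X ≃ Y
Deriv-none⇒≃ (done e) = e

_∘ᶜ_ : Ctx → Ctx → Ctx
hole      ∘ᶜ C = C
parL D S  ∘ᶜ C = parL (D ∘ᶜ C) S
parR S D  ∘ᶜ C = parR S (D ∘ᶜ C)
tensL D S ∘ᶜ C = tensL (D ∘ᶜ C) S
tensR S D ∘ᶜ C = tensR S (D ∘ᶜ C)
seqL D S  ∘ᶜ C = seqL (D ∘ᶜ C) S
seqR S D  ∘ᶜ C = seqR S (D ∘ᶜ C)
whyC D    ∘ᶜ C = whyC (D ∘ᶜ C)
bangC D   ∘ᶜ C = bangC (D ∘ᶜ C)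

∘ᶜ-plug : ∀ D C Z → (D ∘ᶜ C) [ Z ] ≡ D [ C [ Z ] ]
∘ᶜ-plug hole       C Z = refl
∘ᶜ-plug (parL D S)  C Z = cong (λ x → par x S) (∘ᶜ-plug D C Z)
∘ᶜ-plug (parR S D)  C Z = cong (par S) (∘ᶜ-plug D C Z)
∘ᶜ-plug (tensL D S) C Z = cong (λ x → tens x S) (∘ᶜ-plug D C Z)
∘ᶜ-plug (tensR S D) C Z = cong (tens S) (∘ᶜ-plug D C Z)
∘ᶜ-plug (seqL D S)  C Z = cong (λ x → seq x S) (∘ᶜ-plug D C Z)
∘ᶜ-plug (seqR S D)  C Z = cong (seq S) (∘ᶜ-plug D C Z)
∘ᶜ-plug (whyC D)    C Z = cong why (∘ᶜ-plug D C Z)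
∘ᶜ-plug (bangC D)   C Z = cong bang (∘ᶜ-plug D C Z)

plug-cong : ∀ D → X ≃ Y → D [ X ] ≃ D [ Y ]
plug-cong hole        e = e
plug-cong (parL D S)  e = par-cong (plug-cong D e) ≃-refl
plug-cong (parR S D)  e = par-cong ≃-refl (plug-cong D e)
plug-cong (tensL D S) e = tens-cong (plug-cong D e) ≃-refl
plug-cong (tensR S D) e = tens-cong ≃-refl (plug-cong D e)
plug-cong (seqL D S)  e = seq-cong (plug-cong D e) ≃-refl
plug-cong (seqR S D)  e = seq-cong ≃-refl (plug-cong D e)
plug-cong (whyC D)    e = why-cong (plug-cong D e)
plug-cong (bangC D)   e = bang-cong (plug-cong D e)

⟶-unnest : ∀ D C → ((D ∘ᶜ C) [ A ]) ⟶⟨ r ⟩ ((D ∘ᶜ C) [ B ]) → (D [ C [ A ] ]) ⟶⟨ r ⟩ (D [ C [ B ] ])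
⟶-unnest D C = subst₂ (_⟶⟨ _ ⟩_) (∘ᶜ-plug D C _) (∘ᶜ-plug D C _)

⟶-plug : ∀ D → P ⟶⟨ r ⟩ Q → (D [ P ]) ⟶⟨ r ⟩ (D [ Q ])
⟶-plug D (ai↓-inst C a)       = ⟶-unnest D C (ai↓-inst (D ∘ᶜ C) a)
⟶-plug D (ai↑-inst C a)       = ⟶-unnest D C (ai↑-inst (D ∘ᶜ C) a)
⟶-plug D (s-inst C R U T)     = ⟶-unnest D C (s-inst (D ∘ᶜ C) R U T)
⟶-plug D (q↓-inst C R T U V)  = ⟶-unnest D C (q↓-inst (D ∘ᶜ C) R T U V)
⟶-plug D (q↑-inst C R T U V)  = ⟶-unnest D C (q↑-inst (D ∘ᶜ C) R T U V)
⟶-plug D (p↓-inst C R T)      = ⟶-unnest D C (p↓-inst (D ∘ᶜ C) R T)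
⟶-plug D (p↑-inst C R T)      = ⟶-unnest D C (p↑-inst (D ∘ᶜ C) R T)
⟶-plug D (e↓-inst C)          = ⟶-unnest D C (e↓-inst (D ∘ᶜ C))
⟶-plug D (e↑-inst C)          = ⟶-unnest D C (e↑-inst (D ∘ᶜ C))
⟶-plug D (w↓-inst C R)        = ⟶-unnest D C (w↓-inst (D ∘ᶜ C) R)
⟶-plug D (w↑-inst C R)        = ⟶-unnest D C (w↑-inst (D ∘ᶜ C) R)
⟶-plug D (b↓-inst C R)        = ⟶-unnest D C (b↓-inst (D ∘ᶜ C) R)
⟶-plug D (b↑-inst C R)        = ⟶-unnest D C (b↑-inst (D ∘ᶜ C) R)
⟶-plug D (g↓-inst C R)        = ⟶-unnest D C (g↓-inst (D ∘ᶜ C) R)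
⟶-plug D (g↑-inst C R)        = ⟶-unnest D C (g↑-inst (D ∘ᶜ C) R)

Deriv-plug : ∀ D → Deriv 𝓡 X Y → Deriv 𝓡 (D [ X ]) (D [ Y ])
Deriv-plug D (done e)          = done (plug-cong D e)
Deriv-plug D (step r r∈ e i d) = step r r∈ (plug-cong D e) (⟶-plug D i) (Deriv-plug D d)

Deriv-par : Deriv 𝓡 X₁ Y₁ → Deriv 𝓡 X₂ Y₂ → Deriv 𝓡 (par X₁ X₂) (par Y₁ Y₂)
Deriv-par d₁ d₂ = Deriv-plug (parL hole _) d₁ ◅◅ Deriv-plug (parR _ hole) d₂

Deriv-tens : Deriv 𝓡 X₁ Y₁ → Deriv 𝓡 X₂ Y₂ → Deriv 𝓡 (tens X₁ X₂) (tens Y₁ Y₂)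
Deriv-tens d₁ d₂ = Deriv-plug (tensL hole _) d₁ ◅◅ Deriv-plug (tensR _ hole) d₂

Deriv-seq : Deriv 𝓡 X₁ Y₁ → Deriv 𝓡 X₂ Y₂ → Deriv 𝓡 (seq X₁ X₂) (seq Y₁ Y₂)
Deriv-seq d₁ d₂ = Deriv-plug (seqL hole _) d₁ ◅◅ Deriv-plug (seqR _ hole) d₂

-- Pure structures and their insertion in place of ∘

-- The structures derivable from ∘ by e↓ alone (Pure⇒e↓).
data Pure : Str → Set where
  pu : Pure unit
  pb : Pure X → Pure (bang X)
  pp : Pure X → Pure Y → Pure (par X Y)
  pt : Pure X → Pure Y → Pure (tens X Y)
  ps : Pure X → Pure Y → Pure (seq X Y)

Pure-resp-≃  : Y ≃ Y' → Pure Y → Pure Y'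
Pure-resp-≃˘ : Y ≃ Y' → Pure Y' → Pure Y
Pure-resp-≃ ≃-refl             p          = p
Pure-resp-≃ (≃-sym e)          p          = Pure-resp-≃˘ e p
Pure-resp-≃ (≃-trans e f)      p          = Pure-resp-≃ f (Pure-resp-≃ e p)
Pure-resp-≃ (par-cong e f)     (pp p q)   = pp (Pure-resp-≃ e p) (Pure-resp-≃ f q)
Pure-resp-≃ (tens-cong e f)    (pt p q)   = pt (Pure-resp-≃ e p) (Pure-resp-≃ f q)
Pure-resp-≃ (seq-cong e f)     (ps p q)   = ps (Pure-resp-≃ e p) (Pure-resp-≃ f q)
Pure-resp-≃ (bang-cong e)      (pb p)     = pb (Pure-resp-≃ e p)
Pure-resp-≃ (par-assoc _ _ _)  (pp (pp p q) o) = pp p (pp q o)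
Pure-resp-≃ (tens-assoc _ _ _) (pt (pt p q) o) = pt p (pt q o)
Pure-resp-≃ (seq-assoc _ _ _)  (ps (ps p q) o) = ps p (ps q o)
Pure-resp-≃ (par-comm _ _)     (pp p q)   = pp q p
Pure-resp-≃ (tens-comm _ _)    (pt p q)   = pt q p
Pure-resp-≃ (par-unitˡ _)      (pp _ q)   = q
Pure-resp-≃ (par-unitʳ _)      (pp p _)   = p
Pure-resp-≃ (tens-unitˡ _)     (pt _ q)   = q
Pure-resp-≃ (tens-unitʳ _)     (pt p _)   = p
Pure-resp-≃ (seq-unitˡ _)      (ps _ q)   = q
Pure-resp-≃ (seq-unitʳ _)      (ps p _)   = p
Pure-resp-≃˘ ≃-refl             p          = p
Pure-resp-≃˘ (≃-sym e)          p          = Pure-resp-≃ e p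
Pure-resp-≃˘ (≃-trans e f)      p          = Pure-resp-≃˘ e (Pure-resp-≃˘ f p)
Pure-resp-≃˘ (par-cong e f)     (pp p q)   = pp (Pure-resp-≃˘ e p) (Pure-resp-≃˘ f q)
Pure-resp-≃˘ (tens-cong e f)    (pt p q)   = pt (Pure-resp-≃˘ e p) (Pure-resp-≃˘ f q)
Pure-resp-≃˘ (seq-cong e f)     (ps p q)   = ps (Pure-resp-≃˘ e p) (Pure-resp-≃˘ f q)
Pure-resp-≃˘ (bang-cong e)      (pb p)     = pb (Pure-resp-≃˘ e p)
Pure-resp-≃˘ (par-assoc _ _ _)  (pp p (pp q o)) = pp (pp p q) o
Pure-resp-≃˘ (tens-assoc _ _ _) (pt p (pt q o)) = pt (pt p q) o
Pure-resp-≃˘ (seq-assoc _ _ _)  (ps p (ps q o)) = ps (ps p q) o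
Pure-resp-≃˘ (par-comm _ _)     (pp p q)   = pp q p
Pure-resp-≃˘ (tens-comm _ _)    (pt p q)   = pt q p
Pure-resp-≃˘ (par-unitˡ _)      p          = pp pu p
Pure-resp-≃˘ (par-unitʳ _)      p          = pp p pu
Pure-resp-≃˘ (tens-unitˡ _)     p          = pt pu p
Pure-resp-≃˘ (tens-unitʳ _)     p          = pt p pu
Pure-resp-≃˘ (seq-unitˡ _)      p          = ps pu p
Pure-resp-≃˘ (seq-unitʳ _)      p          = ps p pu

Pure-plug : ∀ C → (Pure Z → Pure Z') → Pure (C [ Z ]) → Pure (C [ Z' ])
Pure-plug hole        f p        = f p
Pure-plug (parL C S)  f (pp p q) = pp (Pure-plug C f p) q
Pure-plug (parR S C)  f (pp p q) = pp p (Pure-plug C f q)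
Pure-plug (tensL C S) f (pt p q) = pt (Pure-plug C f p) q
Pure-plug (tensR S C) f (pt p q) = pt p (Pure-plug C f q)
Pure-plug (seqL C S)  f (ps p q) = ps (Pure-plug C f p) q
Pure-plug (seqR S C)  f (ps p q) = ps p (Pure-plug C f q)
Pure-plug (bangC C)   f (pb p)   = pb (Pure-plug C f p)

-- X ⊑ Y: Y is X with some occurrences of ∘ replaced by pure structures.
infix 4 _⊑_ _≲_
data _⊑_ : Str → Str → Set where
  u⊑ : Pure Y → unit ⊑ Y
  a⊑ : ∀ {a} → atom a ⊑ atom a
  p⊑ : X₁ ⊑ Y₁ → X₂ ⊑ Y₂ → par X₁ X₂ ⊑ par Y₁ Y₂
  t⊑ : X₁ ⊑ Y₁ → X₂ ⊑ Y₂ → tens X₁ X₂ ⊑ tens Y₁ Y₂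
  s⊑ : X₁ ⊑ Y₁ → X₂ ⊑ Y₂ → seq X₁ X₂ ⊑ seq Y₁ Y₂
  w⊑ : X ⊑ Y → why X ⊑ why Y
  b⊑ : X ⊑ Y → bang X ⊑ bang Y

_≲_ : Str → Str → Set
X ≲ Y = Σ Str λ X' → (X ≃ X') × (X' ⊑ Y)

⊑-refl : ∀ X → X ⊑ X
⊑-refl (atom a)   = a⊑
⊑-refl unit       = u⊑ pu
⊑-refl (par X Y)  = p⊑ (⊑-refl X) (⊑-refl Y)
⊑-refl (tens X Y) = t⊑ (⊑-refl X) (⊑-refl Y)
⊑-refl (seq X Y)  = s⊑ (⊑-refl X) (⊑-refl Y)
⊑-refl (why X)    = w⊑ (⊑-refl X)
⊑-refl (bang X)   = b⊑ (⊑-refl X)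

⊑⇒≲ : X ⊑ Y → X ≲ Y
⊑⇒≲ x = _ , ≃-refl , x

≲-refl : ∀ X → X ≲ X
≲-refl X = ⊑⇒≲ (⊑-refl X)

≃-≲-trans : X ≃ X' → X' ≲ Y → X ≲ Y
≃-≲-trans e (_ , e' , x) = _ , ≃-trans e e' , x

≲-par : X₁ ≲ Y₁ → X₂ ≲ Y₂ → par X₁ X₂ ≲ par Y₁ Y₂
≲-par (_ , e₁ , x₁) (_ , e₂ , x₂) = _ , par-cong e₁ e₂ , p⊑ x₁ x₂

≲-tens : X₁ ≲ Y₁ → X₂ ≲ Y₂ → tens X₁ X₂ ≲ tens Y₁ Y₂
≲-tens (_ , e₁ , x₁) (_ , e₂ , x₂) = _ , tens-cong e₁ e₂ , t⊑ x₁ x₂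

≲-seq : X₁ ≲ Y₁ → X₂ ≲ Y₂ → seq X₁ X₂ ≲ seq Y₁ Y₂
≲-seq (_ , e₁ , x₁) (_ , e₂ , x₂) = _ , seq-cong e₁ e₂ , s⊑ x₁ x₂

≲-why : X ≲ Y → why X ≲ why Y
≲-why (_ , e , x) = _ , why-cong e , w⊑ x

≲-bang : X ≲ Y → bang X ≲ bang Y
≲-bang (_ , e , x) = _ , bang-cong e , b⊑ x

≲-bind : X ≲ Y → (∀ {X'} → X' ⊑ Y → X' ≲ Z) → X ≲ Z
≲-bind (_ , e , x) f = ≃-≲-trans e (f x)

⊑-resp-≃  : Y ≃ Y' → X ⊑ Y → X ≲ Y'
⊑-resp-≃˘ : Y ≃ Y' → X ⊑ Y' → X ≲ Y
⊑-resp-≃ e                  (u⊑ p)   = ⊑⇒≲ (u⊑ (Pure-resp-≃ e p))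
⊑-resp-≃ ≃-refl             x        = ⊑⇒≲ x
⊑-resp-≃ (≃-sym e)          x        = ⊑-resp-≃˘ e x
⊑-resp-≃ (≃-trans e f)      x        = ≲-bind (⊑-resp-≃ e x) (⊑-resp-≃ f)
⊑-resp-≃ (par-cong e f)     (p⊑ x y) = ≲-par (⊑-resp-≃ e x) (⊑-resp-≃ f y)
⊑-resp-≃ (tens-cong e f)    (t⊑ x y) = ≲-tens (⊑-resp-≃ e x) (⊑-resp-≃ f y)
⊑-resp-≃ (seq-cong e f)     (s⊑ x y) = ≲-seq (⊑-resp-≃ e x) (⊑-resp-≃ f y)
⊑-resp-≃ (why-cong e)       (w⊑ x)   = ≲-why (⊑-resp-≃ e x)
⊑-resp-≃ (bang-cong e)      (b⊑ x)   = ≲-bang (⊑-resp-≃ e x)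
⊑-resp-≃ (par-assoc _ _ _)  (p⊑ (u⊑ (pp p q)) z) =
  _ , par-cong ≃-refl (≃-sym (par-unitˡ _)) , p⊑ (u⊑ p) (p⊑ (u⊑ q) z)
⊑-resp-≃ (par-assoc _ _ _)  (p⊑ (p⊑ x y) z) = _ , par-assoc _ _ _ , p⊑ x (p⊑ y z)
⊑-resp-≃ (tens-assoc _ _ _) (t⊑ (u⊑ (pt p q)) z) =
  _ , tens-cong ≃-refl (≃-sym (tens-unitˡ _)) , t⊑ (u⊑ p) (t⊑ (u⊑ q) z)
⊑-resp-≃ (tens-assoc _ _ _) (t⊑ (t⊑ x y) z) = _ , tens-assoc _ _ _ , t⊑ x (t⊑ y z)
⊑-resp-≃ (seq-assoc _ _ _)  (s⊑ (u⊑ (ps p q)) z) =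
  _ , seq-cong ≃-refl (≃-sym (seq-unitˡ _)) , s⊑ (u⊑ p) (s⊑ (u⊑ q) z)
⊑-resp-≃ (seq-assoc _ _ _)  (s⊑ (s⊑ x y) z) = _ , seq-assoc _ _ _ , s⊑ x (s⊑ y z)
⊑-resp-≃ (par-comm _ _)     (p⊑ x y)        = _ , par-comm _ _ , p⊑ y x
⊑-resp-≃ (tens-comm _ _)    (t⊑ x y)        = _ , tens-comm _ _ , t⊑ y x
⊑-resp-≃ (par-unitˡ _)      (p⊑ (u⊑ _) y)   = _ , par-unitˡ _ , y
⊑-resp-≃ (par-unitʳ _)      (p⊑ x (u⊑ _))   = _ , par-unitʳ _ , x
⊑-resp-≃ (tens-unitˡ _)     (t⊑ (u⊑ _) y)   = _ , tens-unitˡ _ , y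
⊑-resp-≃ (tens-unitʳ _)     (t⊑ x (u⊑ _))   = _ , tens-unitʳ _ , x
⊑-resp-≃ (seq-unitˡ _)      (s⊑ (u⊑ _) y)   = _ , seq-unitˡ _ , y
⊑-resp-≃ (seq-unitʳ _)      (s⊑ x (u⊑ _))   = _ , seq-unitʳ _ , x
⊑-resp-≃˘ e                  (u⊑ p)   = ⊑⇒≲ (u⊑ (Pure-resp-≃˘ e p))
⊑-resp-≃˘ ≃-refl             x        = ⊑⇒≲ x
⊑-resp-≃˘ (≃-sym e)          x        = ⊑-resp-≃ e x
⊑-resp-≃˘ (≃-trans e f)      x        = ≲-bind (⊑-resp-≃˘ f x) (⊑-resp-≃˘ e)
⊑-resp-≃˘ (par-cong e f)     (p⊑ x y) = ≲-par (⊑-resp-≃˘ e x) (⊑-resp-≃˘ f y)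
⊑-resp-≃˘ (tens-cong e f)    (t⊑ x y) = ≲-tens (⊑-resp-≃˘ e x) (⊑-resp-≃˘ f y)
⊑-resp-≃˘ (seq-cong e f)     (s⊑ x y) = ≲-seq (⊑-resp-≃˘ e x) (⊑-resp-≃˘ f y)
⊑-resp-≃˘ (why-cong e)       (w⊑ x)   = ≲-why (⊑-resp-≃˘ e x)
⊑-resp-≃˘ (bang-cong e)      (b⊑ x)   = ≲-bang (⊑-resp-≃˘ e x)
⊑-resp-≃˘ (par-assoc _ _ _)  (p⊑ x (u⊑ (pp p q))) =
  _ , ≃-sym (par-unitʳ _) , p⊑ (p⊑ x (u⊑ p)) (u⊑ q)
⊑-resp-≃˘ (par-assoc _ _ _)  (p⊑ x (p⊑ y z)) = _ , ≃-sym (par-assoc _ _ _) , p⊑ (p⊑ x y) z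
⊑-resp-≃˘ (tens-assoc _ _ _) (t⊑ x (u⊑ (pt p q))) =
  _ , ≃-sym (tens-unitʳ _) , t⊑ (t⊑ x (u⊑ p)) (u⊑ q)
⊑-resp-≃˘ (tens-assoc _ _ _) (t⊑ x (t⊑ y z)) = _ , ≃-sym (tens-assoc _ _ _) , t⊑ (t⊑ x y) z
⊑-resp-≃˘ (seq-assoc _ _ _)  (s⊑ x (u⊑ (ps p q))) =
  _ , ≃-sym (seq-unitʳ _) , s⊑ (s⊑ x (u⊑ p)) (u⊑ q)
⊑-resp-≃˘ (seq-assoc _ _ _)  (s⊑ x (s⊑ y z)) = _ , ≃-sym (seq-assoc _ _ _) , s⊑ (s⊑ x y) z
⊑-resp-≃˘ (par-comm _ _)     (p⊑ x y)        = _ , par-comm _ _ , p⊑ y x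
⊑-resp-≃˘ (tens-comm _ _)    (t⊑ x y)        = _ , tens-comm _ _ , t⊑ y x
⊑-resp-≃˘ (par-unitˡ _)      x               = _ , ≃-sym (par-unitˡ _) , p⊑ (u⊑ pu) x
⊑-resp-≃˘ (par-unitʳ _)      x               = _ , ≃-sym (par-unitʳ _) , p⊑ x (u⊑ pu)
⊑-resp-≃˘ (tens-unitˡ _)     x               = _ , ≃-sym (tens-unitˡ _) , t⊑ (u⊑ pu) x
⊑-resp-≃˘ (tens-unitʳ _)     x               = _ , ≃-sym (tens-unitʳ _) , t⊑ x (u⊑ pu)
⊑-resp-≃˘ (seq-unitˡ _)      x               = _ , ≃-sym (seq-unitˡ _) , s⊑ (u⊑ pu) x
⊑-resp-≃˘ (seq-unitʳ _)      x               = _ , ≃-sym (seq-unitʳ _) , s⊑ x (u⊑ pu)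

≲-resp-≃ : X ≲ Y → Y ≃ Y' → X ≲ Y'
≲-resp-≃ x e = ≲-bind x (⊑-resp-≃ e)

Pure⇒e↓ : Pure Y → unit ─⟨ e↓ ⟩→ Y
Pure⇒e↓ pu       = done ≃-refl
Pure⇒e↓ (pb p)   = step e↓ refl ≃-refl (e↓-inst hole) (Deriv-plug (bangC hole) (Pure⇒e↓ p))
Pure⇒e↓ (pp p q) = Deriv-respˡ-≃ (≃-sym (par-unitˡ unit)) (Deriv-par (Pure⇒e↓ p) (Pure⇒e↓ q))
Pure⇒e↓ (pt p q) = Deriv-respˡ-≃ (≃-sym (tens-unitˡ unit)) (Deriv-tens (Pure⇒e↓ p) (Pure⇒e↓ q))
Pure⇒e↓ (ps p q) = Deriv-respˡ-≃ (≃-sym (seq-unitˡ unit)) (Deriv-seq (Pure⇒e↓ p) (Pure⇒e↓ q))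

⊑⇒e↓ : X ⊑ Y → X ─⟨ e↓ ⟩→ Y
⊑⇒e↓ (u⊑ p)   = Pure⇒e↓ p
⊑⇒e↓ a⊑       = done ≃-refl
⊑⇒e↓ (p⊑ x y) = Deriv-par (⊑⇒e↓ x) (⊑⇒e↓ y)
⊑⇒e↓ (t⊑ x y) = Deriv-tens (⊑⇒e↓ x) (⊑⇒e↓ y)
⊑⇒e↓ (s⊑ x y) = Deriv-seq (⊑⇒e↓ x) (⊑⇒e↓ y)
⊑⇒e↓ (w⊑ x)   = Deriv-plug (whyC hole) (⊑⇒e↓ x)
⊑⇒e↓ (b⊑ x)   = Deriv-plug (bangC hole) (⊑⇒e↓ x)

≲⇒e↓ : X ≲ Y → X ─⟨ e↓ ⟩→ Y
≲⇒e↓ (_ , e , x) = Deriv-respˡ-≃ e (⊑⇒e↓ x)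

-- Replaying derivations on a structure with fewer pure parts

Deriv⊑ : RuleSet → Str → Str → Set
Deriv⊑ 𝓡 X Y = Σ Str λ X' → Deriv 𝓡 X X' × X' ≲ Y

Deriv⊑-none⇒≲ : Deriv⊑ none X Y → X ≲ Y
Deriv⊑-none⇒≲ (_ , d , x) = ≃-≲-trans (Deriv-none⇒≃ d) x

Deriv⊑-frame : ∀ F → (∀ {A} → A ≲ Y → F [ A ] ≲ Y') → Deriv⊑ 𝓡 X Y → Deriv⊑ 𝓡 (F [ X ]) Y'
Deriv⊑-frame F k (A , d , x) = F [ A ] , Deriv-plug F d , k x

Deriv⊑-plug : ∀ C → (∀ {X} → X ⊑ Z → Deriv⊑ 𝓡 X Z') → (Pure Z → Pure Z') →
              X ⊑ C [ Z ] → Deriv⊑ 𝓡 X (C [ Z' ])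
Deriv⊑-plug hole        f g x        = f x
Deriv⊑-plug C           f g (u⊑ p)   = unit , done ≃-refl , ⊑⇒≲ (u⊑ (Pure-plug C g p))
Deriv⊑-plug (parL C S)  f g (p⊑ x y) =
  Deriv⊑-frame (parL hole _) (λ a → ≲-par a (⊑⇒≲ y)) (Deriv⊑-plug C f g x)
Deriv⊑-plug (parR S C)  f g (p⊑ y x) =
  Deriv⊑-frame (parR _ hole) (≲-par (⊑⇒≲ y)) (Deriv⊑-plug C f g x)
Deriv⊑-plug (tensL C S) f g (t⊑ x y) =
  Deriv⊑-frame (tensL hole _) (λ a → ≲-tens a (⊑⇒≲ y)) (Deriv⊑-plug C f g x)
Deriv⊑-plug (tensR S C) f g (t⊑ y x) =
  Deriv⊑-frame (tensR _ hole) (≲-tens (⊑⇒≲ y)) (Deriv⊑-plug C f g x)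
Deriv⊑-plug (seqL C S)  f g (s⊑ x y) =
  Deriv⊑-frame (seqL hole _) (λ a → ≲-seq a (⊑⇒≲ y)) (Deriv⊑-plug C f g x)
Deriv⊑-plug (seqR S C)  f g (s⊑ y x) =
  Deriv⊑-frame (seqR _ hole) (≲-seq (⊑⇒≲ y)) (Deriv⊑-plug C f g x)
Deriv⊑-plug (whyC C)    f g (w⊑ x)   = Deriv⊑-frame (whyC hole) ≲-why (Deriv⊑-plug C f g x)
Deriv⊑-plug (bangC C)   f g (b⊑ x)   = Deriv⊑-frame (bangC hole) ≲-bang (Deriv⊑-plug C f g x)

Simulation : RuleSet → RuleSet → Set
Simulation 𝓢 𝓡 = ∀ {r X P Q} → 𝓢 r → P ⟶⟨ r ⟩ Q → X ⊑ P → Deriv⊑ 𝓡 X Q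

Deriv⊑-simulate : Simulation 𝓢 𝓡 → X ≲ P → Deriv 𝓢 P Q → Deriv⊑ 𝓡 X Q
Deriv⊑-simulate sim x (done e) = _ , done ≃-refl , ≲-resp-≃ x e
Deriv⊑-simulate sim x (step r r∈ e i d) =
  let (X' , X≃X' , x') = ≲-resp-≃ x e
      (A , d₁ , a)     = sim r∈ i x'
      (B , d₂ , b)     = Deriv⊑-simulate sim a d
  in B , Deriv-respˡ-≃ X≃X' (d₁ ◅◅ d₂) , b

-- An e↓ instance needs no replay: its effect is absorbed into ⊑.
e↓-simulation : Simulation (only e↓) none
e↓-simulation refl (e↓-inst C) = Deriv⊑-plug C redex (λ _ → pb pu)
  where redex : X ⊑ unit → Deriv⊑ none X (bang unit)
        redex (u⊑ _) = unit , done ≃-refl , ⊑⇒≲ (u⊑ (pb pu))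

g↑-simulation : Simulation (only g↑) (only g↑)
g↑-simulation refl (g↑-inst C R) = Deriv⊑-plug C redex pb
  where redex : X ⊑ bang R → Deriv⊑ (only g↑) X (bang (bang R))
        redex (u⊑ (pb p)) = unit , done ≃-refl , ⊑⇒≲ (u⊑ (pb (pb p)))
        redex (b⊑ x)      = _ , single refl (g↑-inst hole _) , ⊑⇒≲ (b⊑ (b⊑ x))

b↑-simulation : Simulation (only b↑) (only b↑)
b↑-simulation refl (b↑-inst C R) = Deriv⊑-plug C redex λ { (pb p) → pt (pb p) p }
  where redex : X ⊑ bang R → Deriv⊑ (only b↑) X (tens (bang R) R)
        redex (u⊑ (pb p)) = unit , done ≃-refl , _ , ≃-sym (tens-unitˡ unit) , t⊑ (u⊑ (pb p)) (u⊑ p)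
        redex (b⊑ x)      = _ , single refl (b↑-inst hole _) , ⊑⇒≲ (t⊑ (b⊑ x) x)

w↑-simulation : Simulation (only w↑) (only w↑)
w↑-simulation refl (w↑-inst C R) = Deriv⊑-plug C redex (λ _ → pu)
  where redex : X ⊑ bang R → Deriv⊑ (only w↑) X unit
        redex (u⊑ _) = unit , done ≃-refl , ⊑⇒≲ (u⊑ pu)
        redex (b⊑ _) = unit , single refl (w↑-inst hole _) , ⊑⇒≲ (u⊑ pu)

e↓-permutes-below-g↑b↑w↑ : ∀ {T W₁ W₂ W₃ W₄} →
  T ─⟨ e↓ ⟩→ W₁ → W₁ ─⟨ g↑ ⟩→ W₂ → W₂ ─⟨ b↑ ⟩→ W₃ → W₃ ─⟨ w↑ ⟩→ W₄ →
  Σ Str λ T₁ → Σ Str λ T₂ → Σ Str λ T₃ →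
    (T ─⟨ g↑ ⟩→ T₁) × (T₁ ─⟨ b↑ ⟩→ T₂) × (T₂ ─⟨ w↑ ⟩→ T₃) × (T₃ ─⟨ e↓ ⟩→ W₄)
e↓-permutes-below-g↑b↑w↑ {T} de dg db dw =
  let t  = Deriv⊑-none⇒≲ (Deriv⊑-simulate e↓-simulation (≲-refl T) de)
      (T₁ , d₁ , t₁) = Deriv⊑-simulate g↑-simulation t dg
      (T₂ , d₂ , t₂) = Deriv⊑-simulate b↑-simulation t₁ db
      (T₃ , d₃ , t₃) = Deriv⊑-simulate w↑-simulation t₂ dw
  in T₁ , T₂ , T₃ , d₁ , d₂ , d₃ , ≲⇒e↓ t₃

-- Duality

negᶜ : Ctx → Ctx
negᶜ hole        = hole
negᶜ (parL C S)  = tensL (negᶜ C) (neg S)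
negᶜ (parR S C)  = tensR (neg S) (negᶜ C)
negᶜ (tensL C S) = parL (negᶜ C) (neg S)
negᶜ (tensR S C) = parR (neg S) (negᶜ C)
negᶜ (seqL C S)  = seqL (negᶜ C) (neg S)
negᶜ (seqR S C)  = seqR (neg S) (negᶜ C)
negᶜ (whyC C)    = bangC (negᶜ C)
negᶜ (bangC C)   = whyC (negᶜ C)

negᶜ-plug : ∀ C Z → negᶜ C [ neg Z ] ≡ neg (C [ Z ])
negᶜ-plug hole        Z = refl
negᶜ-plug (parL C S)  Z = cong (λ x → tens x (neg S)) (negᶜ-plug C Z)
negᶜ-plug (parR S C)  Z = cong (tens (neg S)) (negᶜ-plug C Z)
negᶜ-plug (tensL C S) Z = cong (λ x → par x (neg S)) (negᶜ-plug C Z)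
negᶜ-plug (tensR S C) Z = cong (par (neg S)) (negᶜ-plug C Z)
negᶜ-plug (seqL C S)  Z = cong (λ x → seq x (neg S)) (negᶜ-plug C Z)
negᶜ-plug (seqR S C)  Z = cong (seq (neg S)) (negᶜ-plug C Z)
negᶜ-plug (whyC C)    Z = cong bang (negᶜ-plug C Z)
negᶜ-plug (bangC C)   Z = cong why (negᶜ-plug C Z)

neg-cong : X ≃ Y → neg X ≃ neg Y
neg-cong ≃-refl             = ≃-refl
neg-cong (≃-sym e)          = ≃-sym (neg-cong e)
neg-cong (≃-trans e f)      = ≃-trans (neg-cong e) (neg-cong f)
neg-cong (par-cong e f)     = tens-cong (neg-cong e) (neg-cong f)
neg-cong (tens-cong e f)    = par-cong (neg-cong e) (neg-cong f)
neg-cong (seq-cong e f)     = seq-cong (neg-cong e) (neg-cong f)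
neg-cong (why-cong e)       = bang-cong (neg-cong e)
neg-cong (bang-cong e)      = why-cong (neg-cong e)
neg-cong (par-assoc _ _ _)  = tens-assoc _ _ _
neg-cong (tens-assoc _ _ _) = par-assoc _ _ _
neg-cong (seq-assoc _ _ _)  = seq-assoc _ _ _
neg-cong (par-comm _ _)     = tens-comm _ _
neg-cong (tens-comm _ _)    = par-comm _ _
neg-cong (par-unitˡ _)      = tens-unitˡ _
neg-cong (par-unitʳ _)      = tens-unitʳ _
neg-cong (tens-unitˡ _)     = par-unitˡ _
neg-cong (tens-unitʳ _)     = par-unitʳ _
neg-cong (seq-unitˡ _)      = seq-unitˡ _
neg-cong (seq-unitʳ _)      = seq-unitʳ _

dual-involutive : ∀ a → dual (dual a) ≡ a
dual-involutive (n , b) = cong (n ,_) (not-involutive b)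

neg-involutive : ∀ X → neg (neg X) ≡ X
neg-involutive (atom a)   = cong atom (dual-involutive a)
neg-involutive unit       = refl
neg-involutive (par X Y)  = cong₂ par (neg-involutive X) (neg-involutive Y)
neg-involutive (tens X Y) = cong₂ tens (neg-involutive X) (neg-involutive Y)
neg-involutive (seq X Y)  = cong₂ seq (neg-involutive X) (neg-involutive Y)
neg-involutive (why X)    = cong why (neg-involutive X)
neg-involutive (bang X)   = cong bang (neg-involutive X)

dualRule : Rule → Rule
dualRule ai↓ = ai↑
dualRule ai↑ = ai↓
dualRule s   = s
dualRule q↓  = q↑
dualRule q↑  = q↓
dualRule p↓  = p↑
dualRule p↑  = p↓
dualRule e↓  = e↑
dualRule e↑  = e↓
dualRule w↓  = w↑
dualRule w↑  = w↓
dualRule b↓  = b↑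
dualRule b↑  = b↓
dualRule g↓  = g↑
dualRule g↑  = g↓

⟶-unneg : ∀ C → (negᶜ C [ neg A ]) ⟶⟨ r ⟩ (negᶜ C [ neg B ]) → neg (C [ A ]) ⟶⟨ r ⟩ neg (C [ B ])
⟶-unneg C = subst₂ (_⟶⟨ _ ⟩_) (negᶜ-plug C _) (negᶜ-plug C _)

⟶-neg : P ⟶⟨ r ⟩ Q → neg Q ⟶⟨ dualRule r ⟩ neg P
⟶-neg (ai↓-inst C a)      = ⟶-unneg C (ai↑-inst (negᶜ C) (dual a))
⟶-neg (ai↑-inst C a)      = ⟶-unneg C (ai↓-inst (negᶜ C) (dual a))
⟶-neg (s-inst C R U T)    = ⟶-unneg C (s-inst (negᶜ C) (neg R) (neg T) (neg U))
⟶-neg (q↓-inst C R T U V) = ⟶-unneg C (q↑-inst (negᶜ C) (neg R) (neg U) (neg T) (neg V))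
⟶-neg (q↑-inst C R T U V) = ⟶-unneg C (q↓-inst (negᶜ C) (neg R) (neg U) (neg T) (neg V))
⟶-neg (p↓-inst C R T)     = ⟶-unneg C (p↑-inst (negᶜ C) (neg R) (neg T))
⟶-neg (p↑-inst C R T)     = ⟶-unneg C (p↓-inst (negᶜ C) (neg R) (neg T))
⟶-neg (e↓-inst C)         = ⟶-unneg C (e↑-inst (negᶜ C))
⟶-neg (e↑-inst C)         = ⟶-unneg C (e↓-inst (negᶜ C))
⟶-neg (w↓-inst C R)       = ⟶-unneg C (w↑-inst (negᶜ C) (neg R))
⟶-neg (w↑-inst C R)       = ⟶-unneg C (w↓-inst (negᶜ C) (neg R))
⟶-neg (b↓-inst C R)       = ⟶-unneg C (b↑-inst (negᶜ C) (neg R))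
⟶-neg (b↑-inst C R)       = ⟶-unneg C (b↓-inst (negᶜ C) (neg R))
⟶-neg (g↓-inst C R)       = ⟶-unneg C (g↑-inst (negᶜ C) (neg R))
⟶-neg (g↑-inst C R)       = ⟶-unneg C (g↓-inst (negᶜ C) (neg R))

Deriv-neg : X ─⟨ r ⟩→ Y → neg Y ─⟨ dualRule r ⟩→ neg X
Deriv-neg (done e)          = done (neg-cong (≃-sym e))
Deriv-neg (step _ refl e i d) =
  Deriv-neg d ◅◅ step _ refl ≃-refl (⟶-neg i) (done (neg-cong (≃-sym e)))

e↑-permutes-above-w↓b↓g↓ : ∀ {Z₄ Z₃ Z₂ Z₁ R} →
  Z₄ ─⟨ w↓ ⟩→ Z₃ → Z₃ ─⟨ b↓ ⟩→ Z₂ → Z₂ ─⟨ g↓ ⟩→ Z₁ → Z₁ ─⟨ e↑ ⟩→ R →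
  Σ Str λ R₃ → Σ Str λ R₂ → Σ Str λ R₁ →
    (Z₄ ─⟨ e↑ ⟩→ R₃) × (R₃ ─⟨ w↓ ⟩→ R₂) × (R₂ ─⟨ b↓ ⟩→ R₁) × (R₁ ─⟨ g↓ ⟩→ R)
e↑-permutes-above-w↓b↓g↓ {Z₄} {R = R} dw db dg de =
  let (A , B , C , n₁ , n₂ , n₃ , n₄) =
        e↓-permutes-below-g↑b↑w↑ (Deriv-neg de) (Deriv-neg dg) (Deriv-neg db) (Deriv-neg dw)
  in neg C , neg B , neg A ,
     subst (λ X → X ─⟨ e↑ ⟩→ neg C) (neg-involutive Z₄) (Deriv-neg n₄) ,
     Deriv-neg n₃ , Deriv-neg n₂ ,
     subst (neg A ─⟨ g↓ ⟩→_) (neg-involutive R) (Deriv-neg n₁)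

lemma4p12 : ∀ (T W₁ W₂ W₃ W₄ W₅ Z₅ Z₄ Z₃ Z₂ Z₁ R : Str) →
    T ─⟨ e↓ ⟩→ W₁ → W₁ ─⟨ g↑ ⟩→ W₂ → W₂ ─⟨ b↑ ⟩→ W₃ → W₃ ─⟨ w↑ ⟩→ W₄ →
    W₄ ─⟨ ai↓ ⟩→ W₅ → W₅ ─SNELh→ Z₅ → Z₅ ─⟨ ai↑ ⟩→ Z₄ → Z₄ ─⟨ w↓ ⟩→ Z₃ →
    Z₃ ─⟨ b↓ ⟩→ Z₂ → Z₂ ─⟨ g↓ ⟩→ Z₁ → Z₁ ─⟨ e↑ ⟩→ R →
    Σ Str λ T₁ → Σ Str λ T₂ → Σ Str λ T₃ → Σ Str λ T₄ → Σ Str λ T₅ →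
    Σ Str λ R₅ → Σ Str λ R₄ → Σ Str λ R₃ → Σ Str λ R₂ → Σ Str λ R₁ →
      (T ─⟨ g↑ ⟩→ T₁) × (T₁ ─⟨ b↑ ⟩→ T₂) × (T₂ ─⟨ w↑ ⟩→ T₃) × (T₃ ─⟨ e↓ ⟩→ T₄) ×
      (T₄ ─⟨ ai↓ ⟩→ T₅) × (T₅ ─SNELh→ R₅) × (R₅ ─⟨ ai↑ ⟩→ R₄) × (R₄ ─⟨ e↑ ⟩→ R₃) ×
      (R₃ ─⟨ w↓ ⟩→ R₂) × (R₂ ─⟨ b↓ ⟩→ R₁) × (R₁ ─⟨ g↓ ⟩→ R)
lemma4p12 T W₁ W₂ W₃ W₄ W₅ Z₅ Z₄ Z₃ Z₂ Z₁ R de dg db dw dai dS dai' dw' db' dg' de' =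
  let (T₁ , T₂ , T₃ , d₁ , d₂ , d₃ , d₄)   = e↓-permutes-below-g↑b↑w↑ de dg db dw
      (R₃ , R₂ , R₁ , d₈ , d₉ , d₁₀ , d₁₁) = e↑-permutes-above-w↓b↓g↓ dw' db' dg' de'
  in T₁ , T₂ , T₃ , W₄ , W₅ , Z₅ , Z₄ , R₃ , R₂ , R₁ ,
     d₁ , d₂ , d₃ , d₄ , dai , dS , dai' , d₈ , d₉ , d₁₀ , d₁₁
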